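{- For any integer $n\ge 2$ and any integer $d$ with $\lceil n/2\rceil\le d\le n-1$, there is a graph $G$ on $n$ vertices with $\mathrm{czf}(G)=d$.
   Context: All graphs are finite and simple. Constrained zero forcing: start with a set $S\subseteq V(G)$ of colored vertices, all others uncolored. A colored vertex $c$ may force an uncolored vertex $u$ to become colored if $u$ is the only uncolored neighbor of $c$; only vertices of the initial set $S$ may ever force. $S$ is a constrained zero forcing set if some sequence of forces colors all vertices. $\mathrm{czf}(G)$ is the minimum size of a constrained zero forcing set. -}

module Defs where

open import Data.Nat using (ℕ; _≤_)
open import Data.Bool using (Bool; true; false)
open import Data.Fin using (Fin)
open import Data.Fin.Subset using (Subset; _∈_; _∉_; _∪_; ⁅_⁆; ⊤; ∣_∣)
open import Data.Product using (Σ; _×_; ∃)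
open import Relation.Binary.PropositionalEquality using (_≡_; _≢_)

record Graph (n : ℕ) : Set where
  field
    adj   : Fin n → Fin n → Bool
    sym   : ∀ u v → adj u v ≡ adj v u
    irrefl : ∀ v → adj v v ≡ false
open Graph public

record CanForce {n : ℕ} (G : Graph n) (S B : Subset n) (c u : Fin n) : Set where
  field
    c∈S       : c ∈ S
    c∈B       : c ∈ B
    u∉B       : u ∉ B
    adjcu     : adj G c u ≡ true
    onlyUncol : ∀ w → adj G c w ≡ true → w ≢ u → w ∈ B

data Forces {n : ℕ} (G : Graph n) (S : Subset n) : Subset n → Subset n → Set where
  done : ∀ {B} → Forces G S B B
  step : ∀ {B B'} (c u : Fin n) → CanForce G S B c u →
         Forces G S (B ∪ ⁅ u ⁆) B' → Forces G S B B'

IsCZFSet : {n : ℕ} → Graph n → Subset n → Set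
IsCZFSet G S = Forces G S S ⊤

CZF≡ : {n : ℕ} → Graph n → ℕ → Set
CZF≡ {n} G d =
  (Σ (Subset n) (λ S → IsCZFSet G S × ∣ S ∣ ≡ d)) ×
  (∀ (S : Subset n) → IsCZFSet G S → d ≤ ∣ S ∣)

{-# OPTIONS --safe #-}
module Submission where

-- Take k = n − d disjoint edges and m = 2d − n isolated vertices, so that
-- n = 2k + m and d = k + m. A vertex can only be coloured by a force from a
-- neighbour in S, so every constrained zero forcing set dominates the graph;
-- a dominating set must contain every isolated vertex and an endpoint of every
-- edge, whence czf ≥ k + m. Conversely, the isolated vertices together with
-- one endpoint of each edge force the other endpoints.

open import Defs
open import Data.Bool using (Bool; true; false)
open import Data.Empty using (⊥-elim)
open import Data.Fin using (Fin; zero; suc)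
open import Data.Fin.Subset using (Subset; _∈_; _∪_; ⁅_⁆; ⊤; ∣_∣)
open import Data.Fin.Subset.Properties
  using (x∈p∪q⁻; x∈⁅y⁆⇒x≡y; ∪-identityʳ; ∈⊤; ∣⊤∣≡n; p⊆q⇒∣p∣≤∣q∣; ∣p∣≤∣x∷p∣)
open import Data.Nat using (ℕ; suc; _+_; _*_; _∸_; _≤_; s≤s; ⌈_/2⌉)
open import Data.Nat.Properties
open import Data.Product using (Σ; ∃-syntax; _×_; _,_)
open import Data.Sum using (_⊎_; inj₁; inj₂)
open import Data.Vec using (_∷_; here; there)
open import Relation.Binary.PropositionalEquality
  using (_≡_; _≢_; refl; cong; subst; subst₂; module ≡-Reasoning)
  renaming (sym to ≡-sym)

private
  variable
    n : ℕ

HasNeighbourIn : Graph n → Subset n → Fin n → Set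
HasNeighbourIn {n} G S v = ∃[ c ] (c ∈ S × adj G c v ≡ true)

Dominates : Graph n → Subset n → Set
Dominates G S = ∀ v → v ∈ S ⊎ HasNeighbourIn G S v

DominationBound : Graph n → ℕ → Set
DominationBound {n} G d = (S : Subset n) → Dominates G S → d ≤ ∣ S ∣

Forces⇒colouredOrNeighbour : (G : Graph n) {S B B′ : Subset n} →
  Forces G S B B′ → ∀ v → v ∈ B′ → v ∈ B ⊎ HasNeighbourIn G S v
Forces⇒colouredOrNeighbour G done v v∈B = inj₁ v∈B
Forces⇒colouredOrNeighbour G {B = B} (step c u c→u rest) v v∈B′
  with Forces⇒colouredOrNeighbour G rest v v∈B′
... | inj₂ neighbour = inj₂ neighbour
... | inj₁ v∈B∪u with x∈p∪q⁻ B ⁅ u ⁆ v∈B∪u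
...   | inj₁ v∈B = inj₁ v∈B
...   | inj₂ v∈⁅u⁆ with x∈⁅y⁆⇒x≡y u v∈⁅u⁆
...     | refl = inj₂ (c , CanForce.c∈S c→u , CanForce.adjcu c→u)

isCZFSet⇒dominates : (G : Graph n) {S : Subset n} → IsCZFSet G S → Dominates G S
isCZFSet⇒dominates G forcing v = Forces⇒colouredOrNeighbour G forcing v ∈⊤

dominationBound⇒CZF≡ : (G : Graph n) {d : ℕ} (S : Subset n) →
  IsCZFSet G S → ∣ S ∣ ≡ d → DominationBound G d → CZF≡ G d
dominationBound⇒CZF≡ G S isCZF ∣S∣≡d bound =
  (S , isCZF , ∣S∣≡d) , λ T isCZF′ → bound T (isCZFSet⇒dominates G isCZF′)

edgeless : (n : ℕ) → Graph n
edgeless n = record { adj = λ _ _ → false ; sym = λ _ _ → refl ; irrefl = λ _ → refl }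

edgeless-isCZFSet : IsCZFSet (edgeless n) ⊤
edgeless-isCZFSet = done

edgeless-dominationBound : DominationBound (edgeless n) n
edgeless-dominationBound {n} S dom =
  subst (_≤ ∣ S ∣) (∣⊤∣≡n n) (p⊆q⇒∣p∣≤∣q∣ {p = ⊤} (λ {v} _ → self-dominated v))
  where
  self-dominated : ∀ v → v ∈ S
  self-dominated v with dom v
  ... | inj₁ v∈S = v∈S
  ... | inj₂ (_ , _ , ())

K₂⊕ : Graph n → Graph (2 + n)
K₂⊕ {n} G = record { adj = adj′ ; sym = sym′ ; irrefl = irrefl′ }
  where
  adj′ : Fin (2 + n) → Fin (2 + n) → Bool
  adj′ zero          (suc zero)    = true
  adj′ (suc zero)    zero          = true
  adj′ (suc (suc u)) (suc (suc v)) = adj G u v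
  adj′ _             _             = false

  sym′ : ∀ u v → adj′ u v ≡ adj′ v u
  sym′ zero          zero          = refl
  sym′ zero          (suc zero)    = refl
  sym′ zero          (suc (suc v)) = refl
  sym′ (suc zero)    zero          = refl
  sym′ (suc zero)    (suc zero)    = refl
  sym′ (suc zero)    (suc (suc v)) = refl
  sym′ (suc (suc u)) zero          = refl
  sym′ (suc (suc u)) (suc zero)    = refl
  sym′ (suc (suc u)) (suc (suc v)) = sym G u v

  irrefl′ : ∀ v → adj′ v v ≡ false
  irrefl′ zero          = refl
  irrefl′ (suc zero)    = refl
  irrefl′ (suc (suc v)) = irrefl G v

K₂⊕-liftForces : (G : Graph n) (a b : Bool) {S B B′ : Subset n} →
  Forces G S B B′ →
  Forces (K₂⊕ G) (a ∷ b ∷ S) (true ∷ true ∷ B) (true ∷ true ∷ B′)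
K₂⊕-liftForces G a b done = done
K₂⊕-liftForces G a b {S} {B} (step c u c→u rest) =
  step (suc (suc c)) (suc (suc u)) lifted (K₂⊕-liftForces G a b rest)
  where
  open CanForce c→u

  othersColoured : ∀ w → adj (K₂⊕ G) (suc (suc c)) w ≡ true →
    w ≢ suc (suc u) → w ∈ true ∷ true ∷ B
  othersColoured zero          _    _    = here
  othersColoured (suc zero)    _    _    = there here
  othersColoured (suc (suc w)) c~w  w≢u  =
    there (there (onlyUncol w c~w (λ w≡u → w≢u (cong (λ x → suc (suc x)) w≡u))))

  lifted : CanForce (K₂⊕ G) (a ∷ b ∷ S) (true ∷ true ∷ B) (suc (suc c)) (suc (suc u))
  lifted = record
    { c∈S       = there (there c∈S)
    ; c∈B       = there (there c∈B)
    ; u∉B       = λ { (there (there u∈B)) → u∉B u∈B }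
    ; adjcu     = adjcu
    ; onlyUncol = othersColoured
    }

K₂⊕-isCZFSet : (G : Graph n) {S : Subset n} →
  IsCZFSet G S → IsCZFSet (K₂⊕ G) (true ∷ false ∷ S)
K₂⊕-isCZFSet G {S} isCZF =
  step zero (suc zero) 0→1
    (subst (λ X → Forces (K₂⊕ G) (true ∷ false ∷ S) (true ∷ true ∷ X) ⊤)
      (≡-sym (∪-identityʳ S)) (K₂⊕-liftForces G true false isCZF))
  where
  onlyNeighbour : ∀ w → adj (K₂⊕ G) zero w ≡ true →
    w ≢ suc zero → w ∈ true ∷ false ∷ S
  onlyNeighbour (suc zero) _ w≢1 = ⊥-elim (w≢1 refl)

  0→1 : CanForce (K₂⊕ G) (true ∷ false ∷ S) (true ∷ false ∷ S) zero (suc zero)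
  0→1 = record
    { c∈S       = here
    ; c∈B       = here
    ; u∉B       = λ { (there ()) }
    ; adjcu     = refl
    ; onlyUncol = onlyNeighbour
    }

K₂⊕-dominates⇒dominates : (G : Graph n) {a b : Bool} {S : Subset n} →
  Dominates (K₂⊕ G) (a ∷ b ∷ S) → Dominates G S
K₂⊕-dominates⇒dominates G dom v with dom (suc (suc v))
... | inj₁ (there (there v∈S))                      = inj₁ v∈S
... | inj₂ (suc (suc c) , there (there c∈S) , c~v) = inj₂ (c , c∈S , c~v)

K₂⊕-dominationBound : (G : Graph n) {d : ℕ} →
  DominationBound G d → DominationBound (K₂⊕ G) (suc d)
K₂⊕-dominationBound G {d} bound (a ∷ b ∷ S) dom = endpointCounted a b (dom zero)
  where
  d≤∣S∣ : d ≤ ∣ S ∣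
  d≤∣S∣ = bound S (K₂⊕-dominates⇒dominates G dom)

  endpointCounted : ∀ a b → zero ∈ a ∷ b ∷ S ⊎ HasNeighbourIn (K₂⊕ G) (a ∷ b ∷ S) zero →
    suc d ≤ ∣ a ∷ b ∷ S ∣
  endpointCounted true  b     _ = s≤s (≤-trans d≤∣S∣ (∣p∣≤∣x∷p∣ b S))
  endpointCounted false true  _ = s≤s d≤∣S∣
  endpointCounted false false (inj₁ ())
  endpointCounted false false (inj₂ (suc zero , there () , _))

matchingWithIsolated : (k m : ℕ) → Graph (k * 2 + m)
matchingWithIsolated 0       m = edgeless m
matchingWithIsolated (suc k) m = K₂⊕ (matchingWithIsolated k m)

endpointsAndIsolated : (k m : ℕ) → Subset (k * 2 + m)
endpointsAndIsolated 0       m = ⊤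
endpointsAndIsolated (suc k) m = true ∷ false ∷ endpointsAndIsolated k m

∣endpointsAndIsolated∣ : (k m : ℕ) → ∣ endpointsAndIsolated k m ∣ ≡ k + m
∣endpointsAndIsolated∣ 0       m = ∣⊤∣≡n m
∣endpointsAndIsolated∣ (suc k) m = cong suc (∣endpointsAndIsolated∣ k m)

endpointsAndIsolated-isCZFSet : (k m : ℕ) →
  IsCZFSet (matchingWithIsolated k m) (endpointsAndIsolated k m)
endpointsAndIsolated-isCZFSet 0       m = edgeless-isCZFSet
endpointsAndIsolated-isCZFSet (suc k) m =
  K₂⊕-isCZFSet (matchingWithIsolated k m) (endpointsAndIsolated-isCZFSet k m)

matchingWithIsolated-dominationBound : (k m : ℕ) →
  DominationBound (matchingWithIsolated k m) (k + m)
matchingWithIsolated-dominationBound 0       m = edgeless-dominationBound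
matchingWithIsolated-dominationBound (suc k) m =
  K₂⊕-dominationBound (matchingWithIsolated k m) (matchingWithIsolated-dominationBound k m)

matchingWithIsolated-czf : (k m : ℕ) → CZF≡ (matchingWithIsolated k m) (k + m)
matchingWithIsolated-czf k m =
  dominationBound⇒CZF≡ (matchingWithIsolated k m) (endpointsAndIsolated k m)
    (endpointsAndIsolated-isCZFSet k m) (∣endpointsAndIsolated∣ k m)
    (matchingWithIsolated-dominationBound k m)

matchingParameters : (n d : ℕ) → ⌈ n /2⌉ ≤ d → d ≤ n →
  Σ ℕ λ k → Σ ℕ λ m → k * 2 + m ≡ n × k + m ≡ d
matchingParameters n d ⌈n/2⌉≤d d≤n = k , m , k*2+m≡n , k+m≡d
  where
  open ≡-Reasoning
  k = n ∸ d
  m = d ∸ k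

  n≤d+d : n ≤ d + d
  n≤d+d = subst (_≤ d + d) (⌊n/2⌋+⌈n/2⌉≡n n)
            (+-mono-≤ (≤-trans (⌊n/2⌋≤⌈n/2⌉ n) ⌈n/2⌉≤d) ⌈n/2⌉≤d)

  k+m≡d : k + m ≡ d
  k+m≡d = m+[n∸m]≡n (m≤n+o⇒m∸n≤o n d n≤d+d)

  k*2+m≡n : k * 2 + m ≡ n
  k*2+m≡n = begin
    k * 2 + m        ≡⟨ cong (_+ m) (*-comm k 2) ⟩
    k + (k + 0) + m  ≡⟨ cong (λ x → k + x + m) (+-identityʳ k) ⟩
    k + k + m        ≡⟨ +-assoc k k m ⟩
    k + (k + m)      ≡⟨ cong (k +_) k+m≡d ⟩
    k + d            ≡⟨ m∸n+n≡m d≤n ⟩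
    n                ∎

mainTheorem7 : (n d : ℕ) → 2 ≤ n → ⌈ n /2⌉ ≤ d → d ≤ n ∸ 1 →
    Σ (Graph n) (λ G → CZF≡ G d)
mainTheorem7 n d _ ⌈n/2⌉≤d d≤n∸1
  with matchingParameters n d ⌈n/2⌉≤d (≤-trans d≤n∸1 (m∸n≤m n 1))
... | k , m , k*2+m≡n , k+m≡d =
  subst₂ (λ n d → Σ (Graph n) (λ G → CZF≡ G d)) k*2+m≡n k+m≡d
    (matchingWithIsolated k m , matchingWithIsolated-czf k m)
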